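{- Let $k>1$, $n\ge 1$ and $m\ge 0$ be integers with $C_k(n,m)>0$. If $\pi$ is chosen uniformly at random among permutations in $S_n$ with exactly $m$ $k$-cycles, then \[ \mathbb{E}[\pi(1)\mid \pi\in S_n\text{ has exactly } m\ k\text{ -cycles}]=\frac n2\left(1-\frac{C_k(n-1,m)}{C_k(n,m)}\right)+1. \]
   Context: A $k$-cycle of a permutation is a cycle of length exactly $k$ in its disjoint cycle decomposition. $C_k(n,m)$ denotes the number of permutations in $S_n$ with exactly $m$ $k$-cycles, with $S_0$ consisting of the single empty permutation (which has no cycles). -}

module Defs where

open import Data.Nat using (ℕ; zero; suc; _+_; _*_; _∸_; _≡ᵇ_)
open import Data.Nat.ListAction using (sum)
open import Data.Bool.ListAction using (all; any)
open import Data.Bool using (Bool; true; false; _∧_; _∨_; not)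
open import Data.Fin using (Fin; toℕ; _≟_)
open import Data.Vec using (Vec; []; _∷_; lookup; head)
open import Data.List using (List; []; _∷_; map; concatMap; filterᵇ; length; allFin; upTo)
open import Relation.Nullary.Decidable using (⌊_⌋)

vecs : {A : Set} → List A → (l : ℕ) → List (Vec A l)
vecs xs zero    = [] ∷ []
vecs xs (suc l) = concatMap (λ x → map (x ∷_) (vecs xs l)) xs

-- A vector σ : Vec (Fin n) n encodes the map i ↦ lookup σ i.
-- It is a permutation iff that map is injective and surjective.
isInjective : ∀ {n} → Vec (Fin n) n → Bool
isInjective {n} σ = all (λ i → all (λ j → not ⌊ lookup σ i ≟ lookup σ j ⌋ ∨ ⌊ i ≟ j ⌋) (allFin n)) (allFin n)

isSurjective : ∀ {n} → Vec (Fin n) n → Bool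
isSurjective {n} σ = all (λ j → any (λ i → ⌊ lookup σ i ≟ j ⌋) (allFin n)) (allFin n)

Sym : (n : ℕ) → List (Vec (Fin n) n)
Sym n = filterᵇ (λ σ → isInjective σ ∧ isSurjective σ) (vecs (allFin n) n)

iter : ∀ {n} → Vec (Fin n) n → ℕ → Fin n → Fin n
iter σ zero    i = i
iter σ (suc j) i = lookup σ (iter σ j i)

inKCycle : ∀ {n} → ℕ → Vec (Fin n) n → Fin n → Bool
inKCycle k σ i = ⌊ iter σ k i ≟ i ⌋ ∧ all (λ j → not ⌊ iter σ (suc j) i ≟ i ⌋) (upTo (k ∸ 1))

pointsInKCycles : ∀ {n} → ℕ → Vec (Fin n) n → ℕ
pointsInKCycles {n} k σ = length (filterᵇ (inKCycle k σ) (allFin n))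

-- σ has exactly m k-cycles (k ≥ 1): the k-cycles partition the points on them into blocks of size k.
hasExactlyKCycles : ∀ {n} → ℕ → ℕ → Vec (Fin n) n → Bool
hasExactlyKCycles k m σ = pointsInKCycles k σ ≡ᵇ (m * k)

SymKM : ℕ → (n : ℕ) → ℕ → List (Vec (Fin n) n)
SymKM k n m = filterᵇ (hasExactlyKCycles k m) (Sym n)

C : ℕ → ℕ → ℕ → ℕ
C k n m = length (SymKM k n m)

-- π(1), with points 1..n encoded as Fin n = {0..n-1} (so value = toℕ + 1); 0 for n = 0 (unused).
valAt1 : ∀ {n} → Vec (Fin n) n → ℕ
valAt1 {zero}  σ = 0
valAt1 {suc n} σ = suc (toℕ (head σ))

sumVal : ℕ → ℕ → ℕ → ℕ
sumVal k n m = sum (map valAt1 (SymKM k n m))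

-- Write N(x) for the number of permutations σ of {0,…,n} with exactly m k-cycles and σ(0) = x.
-- Then C_k(n+1,m) = Σₓ N(x), and the sum of σ(0)+1 over these permutations is Σₓ (x+1) N(x).
-- Conjugating σ by a permutation π fixing 0 preserves the cycle type and turns σ(0) = x into
-- π(x), so N is constant, say M, on {1,…,n}.  Since k > 1, the permutations with σ(0) = 0 are
-- exactly those of {1,…,n} extended by the fixed point 0, with the same k-cycles, so
-- N(0) = C_k(n,m).  Hence C_k(n+1,m) = C_k(n,m) + nM and the sum is C_k(n,m) + M(2 + ⋯ + (n+1)),
-- which rearranges to the stated ratio.

{-# OPTIONS --safe #-}
module Submission where

module Counting where

  open import Defs
  open import Data.Bool using (Bool; true; false; T; not; _∧_; _∨_)
  open import Data.Bool.ListAction using (and; all; any)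
  open import Data.Bool.Properties using (∧-zeroʳ)
  open import Data.Empty using (⊥-elim)
  open import Data.Fin using (Fin; zero; suc; toℕ; _≟_)
  open import Data.Fin.Permutation using (Permutation′; _⟨$⟩ʳ_; _⟨$⟩ˡ_; inverseˡ; inverseʳ; flip; lift₀; transpose)
  open import Data.Fin.Properties using (suc-injective)
  open import Data.List using (List; []; _∷_; map; filterᵇ; length; concatMap; _++_; cartesianProductWith; allFin; upTo)
  open import Data.List.Membership.Propositional using (_∈_; lose)
  open import Data.List.Membership.Propositional.Properties using (∈-map⁺; ∈-cartesianProductWith⁺; ∈-allFin)
  open import Data.List.Membership.Propositional.Properties.WithK using (unique∧set⇒bag)
  open import Data.List.Properties using (map-∘; map-cong; map-++; map-tabulate)
  open import Data.List.Relation.Binary.BagAndSetEquality using (∼bag⇒↭)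
  open import Data.List.Relation.Binary.Permutation.Propositional using (_↭_)
  import Data.List.Relation.Binary.Permutation.Propositional.Properties as ↭
  import Data.List.Relation.Unary.All as All
  open import Data.List.Relation.Unary.All.Properties using (all⁺; all⁻)
  open import Data.List.Relation.Unary.AllPairs using ([]; _∷_)
  open import Data.List.Relation.Unary.Any using (here; satisfied)
  open import Data.List.Relation.Unary.Any.Properties using (any⁺; any⁻)
  open import Data.List.Relation.Unary.Unique.Propositional using (Unique)
  import Data.List.Relation.Unary.Unique.Propositional.Properties as Unique
  open import Data.Nat using (ℕ; zero; suc; _+_; _*_; _∸_; _<_; s≤s; _≡ᵇ_)
  open import Data.Nat.ListAction using (sum)
  open import Data.Nat.ListAction.Properties using (sum-++; sum-↭)
  open import Data.Nat.Properties using (*-assoc; *-identityˡ; *-identityʳ; *-zeroʳ; *-distribʳ-+; *-distribˡ-+; +-identityʳ; +-suc)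
  open import Data.Nat.Tactic.RingSolver using (solve-∀)
  open import Data.Product using (_,_; ∃)
  open import Data.Vec using (Vec; []; _∷_; lookup; tabulate; head)
  import Data.Vec as Vec
  open import Data.Vec.Properties using (lookup-map; ∷-injectiveˡ; ∷-injectiveʳ; lookup∘tabulate; tabulate∘lookup; tabulate-cong)
  open import Function using (_∘_; id; _⇔_; mk⇔; module Equivalence; module Injection)
  open Equivalence using (to; from)
  open Injection using (injective)
  open import Function.Construct.Composition using (_⇔-∘_)
  open import Function.Construct.Symmetry using (⇔-sym)
  open import Function.Definitions using (Injective; StrictlySurjective)
  open import Function.Properties.Inverse using (↔⇒↣)
  open import Relation.Binary.PropositionalEquality
  open import Relation.Nullary.Decidable using (Dec; yes; no; ⌊_⌋; ⌊⌋-map′; does-⇔; isYes≗does; toWitness; fromWitness)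

  𝟙 : Bool → ℕ
  𝟙 true  = 1
  𝟙 false = 0

  module _ {A : Set} where

    sum-map-filterᵇ : (p : A → Bool) (g : A → ℕ) (xs : List A) →
                      sum (map g (filterᵇ p xs)) ≡ sum (map (λ x → 𝟙 (p x) * g x) xs)
    sum-map-filterᵇ p g [] = refl
    sum-map-filterᵇ p g (x ∷ xs) with p x
    ... | true  = cong₂ _+_ (sym (*-identityˡ (g x))) (sum-map-filterᵇ p g xs)
    ... | false = sum-map-filterᵇ p g xs

    length-filterᵇ : (p : A → Bool) (xs : List A) → length (filterᵇ p xs) ≡ sum (map (𝟙 ∘ p) xs)
    length-filterᵇ p [] = refl
    length-filterᵇ p (x ∷ xs) with p x
    ... | true  = cong suc (length-filterᵇ p xs)
    ... | false = length-filterᵇ p xs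

    sum-map-*ʳ : (f : A → ℕ) (c : ℕ) (xs : List A) → sum (map (λ x → f x * c) xs) ≡ sum (map f xs) * c
    sum-map-*ʳ f c [] = refl
    sum-map-*ʳ f c (x ∷ xs) = trans (cong (f x * c +_) (sum-map-*ʳ f c xs)) (sym (*-distribʳ-+ c (f x) _))

    sum-map-*ˡ : (c : ℕ) (f : A → ℕ) (xs : List A) → sum (map (λ x → c * f x) xs) ≡ c * sum (map f xs)
    sum-map-*ˡ c f [] = sym (*-zeroʳ c)
    sum-map-*ˡ c f (x ∷ xs) = trans (cong (c * f x +_) (sum-map-*ˡ c f xs)) (sym (*-distribˡ-+ c (f x) _))

    sum-map-cong : ∀ {f g : A → ℕ} → (∀ x → f x ≡ g x) → ∀ xs → sum (map f xs) ≡ sum (map g xs)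
    sum-map-cong f≗g xs = cong sum (map-cong f≗g xs)

    sum-map-zero : (f : A → ℕ) (xs : List A) → (∀ x → f x ≡ 0) → sum (map f xs) ≡ 0
    sum-map-zero f [] _ = refl
    sum-map-zero f (x ∷ xs) f≡0 rewrite f≡0 x = sum-map-zero f xs f≡0

    sum-concatMap : ∀ {B : Set} (g : B → ℕ) (f : A → List B) (xs : List A) →
                    sum (map g (concatMap f xs)) ≡ sum (map (λ x → sum (map g (f x))) xs)
    sum-concatMap g f [] = refl
    sum-concatMap g f (x ∷ xs) = begin
      sum (map g (f x ++ concatMap f xs))               ≡⟨ cong sum (map-++ g (f x) _) ⟩
      sum (map g (f x) ++ map g (concatMap f xs))       ≡⟨ sum-++ (map g (f x)) _ ⟩
      sum (map g (f x)) + sum (map g (concatMap f xs))  ≡⟨ cong (sum (map g (f x)) +_) (sum-concatMap g f xs) ⟩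
      sum (map (λ x → sum (map g (f x))) (x ∷ xs))      ∎
      where open ≡-Reasoning

    unique∧complete⇒↭ : ∀ {xs ys : List A} → Unique xs → Unique ys →
                        (∀ x → x ∈ xs) → (∀ x → x ∈ ys) → xs ↭ ys
    unique∧complete⇒↭ uxs uys xs-complete ys-complete =
      ∼bag⇒↭ (unique∧set⇒bag uxs uys (mk⇔ (λ _ → ys-complete _) (λ _ → xs-complete _)))

    sum-map-reindex : (xs : List A) → Unique xs → (∀ x → x ∈ xs) →
                      (f f⁻¹ : A → A) → (∀ x → f⁻¹ (f x) ≡ x) → (∀ x → f (f⁻¹ x) ≡ x) →
                      (g : A → ℕ) → sum (map (g ∘ f) xs) ≡ sum (map g xs)
    sum-map-reindex xs uxs complete f f⁻¹ f⁻¹∘f f∘f⁻¹ g = begin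
      sum (map (g ∘ f) xs)    ≡⟨ cong sum (map-∘ xs) ⟩
      sum (map g (map f xs))  ≡⟨ sum-↭ (↭.map⁺ g map-f-xs↭xs) ⟩
      sum (map g xs)          ∎
      where
      open ≡-Reasoning
      f-injective : ∀ {x y} → f x ≡ f y → x ≡ y
      f-injective {x} {y} fx≡fy = trans (sym (f⁻¹∘f x)) (trans (cong f⁻¹ fx≡fy) (f⁻¹∘f y))
      f-onto : ∀ x → x ∈ map f xs
      f-onto x = subst (_∈ map f xs) (f∘f⁻¹ x) (∈-map⁺ f (complete (f⁻¹ x)))
      map-f-xs↭xs : map f xs ↭ xs
      map-f-xs↭xs = unique∧complete⇒↭ (Unique.map⁺ f-injective uxs) uxs f-onto complete

  allFin-suc : ∀ n → allFin (suc n) ≡ zero ∷ map suc (allFin n)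
  allFin-suc n = cong (zero ∷_) (sym (map-tabulate id suc))

  sum-allFin-suc : ∀ n (f : Fin (suc n) → ℕ) →
                   sum (map f (allFin (suc n))) ≡ f zero + sum (map (f ∘ suc) (allFin n))
  sum-allFin-suc n f = trans (cong (sum ∘ map f) (allFin-suc n)) (cong (λ xs → f zero + sum xs) (sym (map-∘ (allFin n))))

  sum-allFin-const : ∀ n (c : ℕ) → sum (map (λ (_ : Fin n) → c) (allFin n)) ≡ n * c
  sum-allFin-const zero    c = refl
  sum-allFin-const (suc n) c = trans (sum-allFin-suc n (λ _ → c)) (cong (c +_) (sum-allFin-const n c))

  sum-allFin-indicator : ∀ n (h : Fin n → ℕ) (x : Fin n) →
                         sum (map (λ y → h y * 𝟙 ⌊ y ≟ x ⌋) (allFin n)) ≡ h x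
  sum-allFin-indicator (suc n) h zero = begin
    sum (map (λ y → h y * 𝟙 ⌊ y ≟ zero ⌋) (allFin (suc n)))
      ≡⟨ sum-allFin-suc n _ ⟩
    h zero * 1 + sum (map (λ y → h (suc y) * 0) (allFin n))
      ≡⟨ cong₂ _+_ (*-identityʳ (h zero)) (sum-map-zero _ (allFin n) (*-zeroʳ ∘ h ∘ suc)) ⟩
    h zero + 0
      ≡⟨ +-identityʳ (h zero) ⟩
    h zero
      ∎
    where open ≡-Reasoning
  sum-allFin-indicator (suc n) h (suc x) = begin
    sum (map (λ y → h y * 𝟙 ⌊ y ≟ suc x ⌋) (allFin (suc n)))
      ≡⟨ sum-allFin-suc n (λ y → h y * 𝟙 ⌊ y ≟ suc x ⌋) ⟩
    h zero * 0 + sum (map (λ y → h (suc y) * 𝟙 ⌊ suc y ≟ suc x ⌋) (allFin n))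
      ≡⟨ cong₂ _+_ (*-zeroʳ (h zero))
                   (sum-map-cong (λ y → cong (λ b → h (suc y) * 𝟙 b) (⌊⌋-map′ (cong suc) suc-injective (y ≟ x))) (allFin n)) ⟩
    sum (map (λ y → h (suc y) * 𝟙 ⌊ y ≟ x ⌋) (allFin n))
      ≡⟨ sum-allFin-indicator n (h ∘ suc) x ⟩
    h (suc x)
      ∎
    where open ≡-Reasoning

  arithmetic-series : ∀ n a → 2 * sum (map (λ y → suc a + toℕ y) (allFin n)) ≡ n * (2 * a + suc n)
  arithmetic-series zero    a = refl
  arithmetic-series (suc n) a = begin
    2 * sum (map (λ y → suc a + toℕ y) (allFin (suc n)))
      ≡⟨ cong (2 *_) (sum-allFin-suc n (λ y → suc a + toℕ y)) ⟩
    2 * (suc a + 0 + S)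
      ≡⟨ cong (λ t → 2 * (suc a + 0 + t)) (sum-map-cong (λ y → +-suc (suc a) (toℕ y)) (allFin n)) ⟩
    2 * (suc a + 0 + S′)
      ≡⟨ regroup a S′ ⟩
    2 * suc a + 2 * S′
      ≡⟨ cong (2 * suc a +_) (arithmetic-series n (suc a)) ⟩
    2 * suc a + n * (2 * suc a + suc n)
      ≡⟨ expand a n ⟩
    suc n * (2 * a + suc (suc n))
      ∎
    where
    open ≡-Reasoning
    S  = sum (map (λ y → suc a + suc (toℕ y)) (allFin n))
    S′ = sum (map (λ y → suc (suc a) + toℕ y) (allFin n))
    regroup : ∀ a S → 2 * (suc a + 0 + S) ≡ 2 * suc a + 2 * S
    regroup = solve-∀
    expand : ∀ a n → 2 * suc a + n * (2 * suc a + suc n) ≡ suc n * (2 * a + suc (suc n))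
    expand = solve-∀

  module _ {A : Set} where

    vecs-suc : (xs : List A) (l : ℕ) → vecs xs (suc l) ≡ cartesianProductWith _∷_ xs (vecs xs l)
    vecs-suc xs l = go xs
      where
      go : (ys : List A) → concatMap (λ y → map (y ∷_) (vecs xs l)) ys ≡ cartesianProductWith _∷_ ys (vecs xs l)
      go []       = refl
      go (y ∷ ys) = cong (map (y ∷_) (vecs xs l) ++_) (go ys)

    vecs-unique : (xs : List A) → Unique xs → (l : ℕ) → Unique (vecs xs l)
    vecs-unique xs uxs zero    = All.[] ∷ []
    vecs-unique xs uxs (suc l) rewrite vecs-suc xs l =
      Unique.cartesianProductWith⁺ _∷_ (λ eq → ∷-injectiveˡ eq , ∷-injectiveʳ eq) uxs (vecs-unique xs uxs l)

    ∈-vecs : (xs : List A) → (∀ x → x ∈ xs) → (l : ℕ) (v : Vec A l) → v ∈ vecs xs l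
    ∈-vecs xs complete zero    []      = here refl
    ∈-vecs xs complete (suc l) (x ∷ v) rewrite vecs-suc xs l =
      ∈-cartesianProductWith⁺ _∷_ (complete x) (∈-vecs xs complete l v)

    sum-vecs-suc : (xs : List A) (l : ℕ) (g : Vec A (suc l) → ℕ) →
                   sum (map g (vecs xs (suc l))) ≡ sum (map (λ x → sum (map (g ∘ (x ∷_)) (vecs xs l))) xs)
    sum-vecs-suc xs l g =
      trans (sum-concatMap g (λ x → map (x ∷_) (vecs xs l)) xs)
            (sum-map-cong (λ x → cong sum (sym (map-∘ (vecs xs l)))) xs)

    sum-vecs-∷-vanishing : (a : A) (xs : List A) (l : ℕ) (g : Vec A l → ℕ) →
                           (∀ v i → lookup v i ≡ a → g v ≡ 0) →
                           sum (map g (vecs (a ∷ xs) l)) ≡ sum (map g (vecs xs l))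
    sum-vecs-∷-vanishing a xs zero    g vanish = refl
    sum-vecs-∷-vanishing a xs (suc l) g vanish = begin
      sum (map g (vecs (a ∷ xs) (suc l)))
        ≡⟨ sum-vecs-suc (a ∷ xs) l g ⟩
      sum (map (g ∘ (a ∷_)) (vecs (a ∷ xs) l)) + sum (map (λ x → sum (map (g ∘ (x ∷_)) (vecs (a ∷ xs) l))) xs)
        ≡⟨ cong₂ _+_ (sum-map-zero _ (vecs (a ∷ xs) l) (λ v → vanish (a ∷ v) zero refl))
                     (sum-map-cong (λ x → sum-vecs-∷-vanishing a xs l (g ∘ (x ∷_)) (λ v i → vanish (x ∷ v) (suc i))) xs) ⟩
      sum (map (λ x → sum (map (g ∘ (x ∷_)) (vecs xs l))) xs)
        ≡⟨ sym (sum-vecs-suc xs l g) ⟩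
      sum (map g (vecs xs (suc l))) ∎
      where open ≡-Reasoning

    vecs-map : ∀ {B : Set} (f : A → B) (xs : List A) (l : ℕ) → vecs (map f xs) l ≡ map (Vec.map f) (vecs xs l)
    vecs-map f xs zero    = refl
    vecs-map f xs (suc l) = trans (cong (λ V → concatMap (λ y → map (y ∷_) V) (map f xs)) (vecs-map f xs l)) (go xs)
      where
      go : (ys : List A) → concatMap (λ y → map (y ∷_) (map (Vec.map f) (vecs xs l))) (map f ys)
                         ≡ map (Vec.map f) (concatMap (λ y → map (y ∷_) (vecs xs l)) ys)
      go []       = refl
      go (y ∷ ys) = trans (cong₂ _++_ (trans (sym (map-∘ (vecs xs l))) (map-∘ (vecs xs l))) (go ys))
                          (sym (map-++ (Vec.map f) (map (y ∷_) (vecs xs l)) _))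

  T-⇔⇒≡ : ∀ {a b} → T a ⇔ T b → a ≡ b
  T-⇔⇒≡ {false} {false} _   = refl
  T-⇔⇒≡ {false} {true}  a⇔b = ⊥-elim (from a⇔b _)
  T-⇔⇒≡ {true}  {false} a⇔b = ⊥-elim (to a⇔b _)
  T-⇔⇒≡ {true}  {true}  _   = refl

  ⌊⌋-⇔ : ∀ {P Q : Set} → P ⇔ Q → (p? : Dec P) (q? : Dec Q) → ⌊ p? ⌋ ≡ ⌊ q? ⌋
  ⌊⌋-⇔ P⇔Q p? q? = trans (isYes≗does p?) (trans (does-⇔ P⇔Q p? q?) (sym (isYes≗does q?)))

  module _ {n : ℕ} where

    T-all-allFin : (p : Fin n → Bool) → T (all p (allFin n)) ⇔ (∀ i → T (p i))
    T-all-allFin p = mk⇔ (λ t i → All.lookup (all⁺ p (allFin n) t) (∈-allFin i))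
                         (λ t → all⁻ p {allFin n} (All.tabulate (λ {i} _ → t i)))

    T-any-allFin : (p : Fin n → Bool) → T (any p (allFin n)) ⇔ (∃ λ i → T (p i))
    T-any-allFin p = mk⇔ (satisfied ∘ any⁻ p (allFin n)) (λ (i , t) → any⁺ {xs = allFin n} p (lose (∈-allFin i) t))

    isPermutation : Vec (Fin n) n → Bool
    isPermutation σ = isInjective σ ∧ isSurjective σ

    T-isInjective : (σ : Vec (Fin n) n) → T (isInjective σ) ⇔ Injective _≡_ _≡_ (lookup σ)
    T-isInjective σ = mk⇔
      (λ t {i} {j} → to (pointwise i j) (to (T-all-allFin _) (to (T-all-allFin _) t i) j))
      (λ inj → from (T-all-allFin _) λ i → from (T-all-allFin _) λ j → from (pointwise i j) inj)
      where
      pointwise : ∀ i j → T (not ⌊ lookup σ i ≟ lookup σ j ⌋ ∨ ⌊ i ≟ j ⌋) ⇔ (lookup σ i ≡ lookup σ j → i ≡ j)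
      pointwise i j with lookup σ i ≟ lookup σ j
      ... | yes σi≡σj = mk⇔ (λ t _ → toWitness t) (λ inj → fromWitness (inj σi≡σj))
      ... | no  σi≢σj = mk⇔ (λ _ σi≡σj → ⊥-elim (σi≢σj σi≡σj)) _

    T-isSurjective : (σ : Vec (Fin n) n) → T (isSurjective σ) ⇔ StrictlySurjective _≡_ (lookup σ)
    T-isSurjective σ = mk⇔
      (λ t j → let (i , σi≟j) = to (T-any-allFin _) (to (T-all-allFin _) t j) in i , toWitness σi≟j)
      (λ surj → from (T-all-allFin _) λ j → let (i , σi≡j) = surj j in from (T-any-allFin _) (i , fromWitness σi≡j))

  inKCycle-cong : ∀ {n n′} k (σ : Vec (Fin n) n) (τ : Vec (Fin n′) n′) i i′ →
                  (∀ j → ⌊ iter σ j i ≟ i ⌋ ≡ ⌊ iter τ j i′ ≟ i′ ⌋) → inKCycle k σ i ≡ inKCycle k τ i′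
  inKCycle-cong k σ τ i i′ returns =
    cong₂ _∧_ (returns k) (cong and (map-cong (λ j → cong not (returns (suc j))) (upTo (k ∸ 1))))

  conj : ∀ {n} → Permutation′ n → Vec (Fin n) n → Vec (Fin n) n
  conj π σ = tabulate (λ i → π ⟨$⟩ʳ lookup σ (π ⟨$⟩ˡ i))

  module _ {n : ℕ} (π : Permutation′ n) where

    lookup-conj : ∀ σ i → lookup (conj π σ) i ≡ π ⟨$⟩ʳ lookup σ (π ⟨$⟩ˡ i)
    lookup-conj σ i = lookup∘tabulate _ i

    conj-flip-conj : ∀ σ → conj (flip π) (conj π σ) ≡ σ
    conj-flip-conj σ = trans (tabulate-cong pointwise) (tabulate∘lookup σ)
      where
      pointwise : ∀ i → π ⟨$⟩ˡ lookup (conj π σ) (π ⟨$⟩ʳ i) ≡ lookup σ i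
      pointwise i = begin
        π ⟨$⟩ˡ lookup (conj π σ) (π ⟨$⟩ʳ i)          ≡⟨ cong (π ⟨$⟩ˡ_) (lookup-conj σ (π ⟨$⟩ʳ i)) ⟩
        π ⟨$⟩ˡ (π ⟨$⟩ʳ lookup σ (π ⟨$⟩ˡ (π ⟨$⟩ʳ i)))  ≡⟨ inverseˡ π ⟩
        lookup σ (π ⟨$⟩ˡ (π ⟨$⟩ʳ i))                 ≡⟨ cong (lookup σ) (inverseˡ π) ⟩
        lookup σ i                                   ∎
        where open ≡-Reasoning

    injective-conj : ∀ σ → Injective _≡_ _≡_ (lookup σ) → Injective _≡_ _≡_ (lookup (conj π σ))
    injective-conj σ σ-injective {i} {j} eq =
      injective (↔⇒↣ (flip π)) (σ-injective (injective (↔⇒↣ π) (trans (sym (lookup-conj σ i)) (trans eq (lookup-conj σ j)))))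

    surjective-conj : ∀ σ → StrictlySurjective _≡_ (lookup σ) → StrictlySurjective _≡_ (lookup (conj π σ))
    surjective-conj σ σ-surjective j =
      let (i , σi≡π⁻¹j) = σ-surjective (π ⟨$⟩ˡ j) in
      π ⟨$⟩ʳ i , (begin
        lookup (conj π σ) (π ⟨$⟩ʳ i)            ≡⟨ lookup-conj σ (π ⟨$⟩ʳ i) ⟩
        π ⟨$⟩ʳ lookup σ (π ⟨$⟩ˡ (π ⟨$⟩ʳ i))     ≡⟨ cong (λ x → π ⟨$⟩ʳ lookup σ x) (inverseˡ π) ⟩
        π ⟨$⟩ʳ lookup σ i                       ≡⟨ cong (π ⟨$⟩ʳ_) σi≡π⁻¹j ⟩
        π ⟨$⟩ʳ (π ⟨$⟩ˡ j)                       ≡⟨ inverseʳ π ⟩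
        j                                       ∎)
      where open ≡-Reasoning

    iter-conj : ∀ σ j i → iter (conj π σ) j i ≡ π ⟨$⟩ʳ iter σ j (π ⟨$⟩ˡ i)
    iter-conj σ zero    i = sym (inverseʳ π)
    iter-conj σ (suc j) i = begin
      lookup (conj π σ) (iter (conj π σ) j i)                ≡⟨ cong (lookup (conj π σ)) (iter-conj σ j i) ⟩
      lookup (conj π σ) (π ⟨$⟩ʳ iter σ j (π ⟨$⟩ˡ i))         ≡⟨ lookup-conj σ _ ⟩
      π ⟨$⟩ʳ lookup σ (π ⟨$⟩ˡ (π ⟨$⟩ʳ iter σ j (π ⟨$⟩ˡ i)))  ≡⟨ cong (λ x → π ⟨$⟩ʳ lookup σ x) (inverseˡ π) ⟩
      π ⟨$⟩ʳ lookup σ (iter σ j (π ⟨$⟩ˡ i))                  ∎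
      where open ≡-Reasoning

    inKCycle-conj : ∀ k σ i → inKCycle k (conj π σ) i ≡ inKCycle k σ (π ⟨$⟩ˡ i)
    inKCycle-conj k σ i = inKCycle-cong k (conj π σ) σ i (π ⟨$⟩ˡ i) λ j →
      trans (cong (λ x → ⌊ x ≟ i ⌋) (iter-conj σ j i)) (⌊⌋-⇔ (mk⇔ apply-π⁻¹ apply-π) _ _)
      where
      apply-π⁻¹ : ∀ {x} → π ⟨$⟩ʳ x ≡ i → x ≡ π ⟨$⟩ˡ i
      apply-π⁻¹ eq = trans (sym (inverseˡ π)) (cong (π ⟨$⟩ˡ_) eq)
      apply-π : ∀ {x} → x ≡ π ⟨$⟩ˡ i → π ⟨$⟩ʳ x ≡ i
      apply-π eq = trans (cong (π ⟨$⟩ʳ_) eq) (inverseʳ π)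

    pointsInKCycles-conj : ∀ k σ → pointsInKCycles k (conj π σ) ≡ pointsInKCycles k σ
    pointsInKCycles-conj k σ = begin
      length (filterᵇ (inKCycle k (conj π σ)) (allFin n))
        ≡⟨ length-filterᵇ _ (allFin n) ⟩
      sum (map (𝟙 ∘ inKCycle k (conj π σ)) (allFin n))
        ≡⟨ sum-map-cong (cong 𝟙 ∘ inKCycle-conj k σ) (allFin n) ⟩
      sum (map (λ i → 𝟙 (inKCycle k σ (π ⟨$⟩ˡ i))) (allFin n))
        ≡⟨ sum-map-reindex (allFin n) (Unique.allFin⁺ n) ∈-allFin
                           (π ⟨$⟩ˡ_) (π ⟨$⟩ʳ_) (λ _ → inverseʳ π) (λ _ → inverseˡ π) _ ⟩
      sum (map (𝟙 ∘ inKCycle k σ) (allFin n))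
        ≡⟨ length-filterᵇ _ (allFin n) ⟨
      length (filterᵇ (inKCycle k σ) (allFin n))
        ∎
      where open ≡-Reasoning

  conj-invariant : ∀ {n} (b : Vec (Fin n) n → Bool) → (∀ π σ → T (b σ) → T (b (conj π σ))) →
                   ∀ π σ → b (conj π σ) ≡ b σ
  conj-invariant b preserved π σ =
    T-⇔⇒≡ (mk⇔ (λ t → subst (T ∘ b) (conj-flip-conj π σ) (preserved (flip π) (conj π σ) t)) (preserved π σ))

  isPermutation-conj : ∀ {n} (π : Permutation′ n) σ → isPermutation (conj π σ) ≡ isPermutation σ
  isPermutation-conj π σ = cong₂ _∧_
    (conj-invariant isInjective
      (λ π σ → from (T-isInjective (conj π σ)) ∘ injective-conj π σ ∘ to (T-isInjective σ)) π σ)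
    (conj-invariant isSurjective
      (λ π σ → from (T-isSurjective (conj π σ)) ∘ surjective-conj π σ ∘ to (T-isSurjective σ)) π σ)

  fix₀ : ∀ {n} → Vec (Fin n) n → Vec (Fin (suc n)) (suc n)
  fix₀ ρ = zero ∷ Vec.map suc ρ

  module _ {n : ℕ} (ρ : Vec (Fin n) n) where

    lookup-fix₀ : ∀ i → lookup (fix₀ ρ) (suc i) ≡ suc (lookup ρ i)
    lookup-fix₀ i = lookup-map i suc ρ

    injective-fix₀ : Injective _≡_ _≡_ (lookup (fix₀ ρ)) ⇔ Injective _≡_ _≡_ (lookup ρ)
    injective-fix₀ = mk⇔ restrict extend
      where
      restrict : Injective _≡_ _≡_ (lookup (fix₀ ρ)) → Injective _≡_ _≡_ (lookup ρ)
      restrict inj {i} {j} eq = suc-injective (inj (trans (lookup-fix₀ i) (trans (cong suc eq) (sym (lookup-fix₀ j)))))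
      extend : Injective _≡_ _≡_ (lookup ρ) → Injective _≡_ _≡_ (lookup (fix₀ ρ))
      extend inj {zero}  {zero}  _  = refl
      extend inj {zero}  {suc j} eq with () ← trans eq (lookup-fix₀ j)
      extend inj {suc i} {zero}  eq with () ← trans (sym (lookup-fix₀ i)) eq
      extend inj {suc i} {suc j} eq = cong suc (inj (suc-injective (trans (sym (lookup-fix₀ i)) (trans eq (lookup-fix₀ j)))))

    surjective-fix₀ : StrictlySurjective _≡_ (lookup (fix₀ ρ)) ⇔ StrictlySurjective _≡_ (lookup ρ)
    surjective-fix₀ = mk⇔ restrict extend
      where
      restrict : StrictlySurjective _≡_ (lookup (fix₀ ρ)) → StrictlySurjective _≡_ (lookup ρ)
      restrict surj j with surj (suc j)
      ... | suc i , eq = i , suc-injective (trans (sym (lookup-fix₀ i)) eq)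
      extend : StrictlySurjective _≡_ (lookup ρ) → StrictlySurjective _≡_ (lookup (fix₀ ρ))
      extend surj zero    = zero , refl
      extend surj (suc j) = let (i , eq) = surj j in suc i , trans (lookup-fix₀ i) (cong suc eq)

    isPermutation-fix₀ : isPermutation (fix₀ ρ) ≡ isPermutation ρ
    isPermutation-fix₀ = cong₂ _∧_
      (T-⇔⇒≡ (⇔-sym (T-isInjective ρ) ⇔-∘ (injective-fix₀ ⇔-∘ T-isInjective (fix₀ ρ))))
      (T-⇔⇒≡ (⇔-sym (T-isSurjective ρ) ⇔-∘ (surjective-fix₀ ⇔-∘ T-isSurjective (fix₀ ρ))))

    iter-fix₀-suc : ∀ j i → iter (fix₀ ρ) j (suc i) ≡ suc (iter ρ j i)
    iter-fix₀-suc zero    i = refl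
    iter-fix₀-suc (suc j) i = trans (cong (lookup (fix₀ ρ)) (iter-fix₀-suc j i)) (lookup-fix₀ _)

    pointsInKCycles-fix₀ : ∀ k → 1 < k → pointsInKCycles k (fix₀ ρ) ≡ pointsInKCycles k ρ
    pointsInKCycles-fix₀ k (s≤s (s≤s _)) = begin
      length (filterᵇ (inKCycle k (fix₀ ρ)) (allFin (suc n)))
        ≡⟨ length-filterᵇ _ (allFin (suc n)) ⟩
      sum (map (𝟙 ∘ inKCycle k (fix₀ ρ)) (allFin (suc n)))
        ≡⟨ sum-allFin-suc n (𝟙 ∘ inKCycle k (fix₀ ρ)) ⟩
      𝟙 (inKCycle k (fix₀ ρ) zero) + sum (map (𝟙 ∘ inKCycle k (fix₀ ρ) ∘ suc) (allFin n))
        -- the conjunct σ¹(0) ≢ 0 of inKCycle k (fix₀ ρ) zero computes to false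
        ≡⟨ cong₂ _+_ (cong 𝟙 (∧-zeroʳ _)) (sum-map-cong (cong 𝟙 ∘ inKCycle-suc) (allFin n)) ⟩
      sum (map (𝟙 ∘ inKCycle k ρ) (allFin n))
        ≡⟨ length-filterᵇ _ (allFin n) ⟨
      length (filterᵇ (inKCycle k ρ) (allFin n))
        ∎
      where
      open ≡-Reasoning
      inKCycle-suc : ∀ i → inKCycle k (fix₀ ρ) (suc i) ≡ inKCycle k ρ i
      inKCycle-suc i = inKCycle-cong k (fix₀ ρ) ρ (suc i) i λ j →
        trans (cong (λ x → ⌊ x ≟ suc i ⌋) (iter-fix₀-suc j i)) (⌊⌋-map′ (cong suc) suc-injective (iter ρ j i ≟ i))

  weight : ∀ {n} → ℕ → ℕ → Vec (Fin n) n → ℕ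
  weight k m σ = 𝟙 (isPermutation σ) * 𝟙 (hasExactlyKCycles k m σ)

  module _ (k m : ℕ) where

    C≡sum-weight : ∀ n → C k n m ≡ sum (map (weight k m) (vecs (allFin n) n))
    C≡sum-weight n =
      trans (length-filterᵇ _ (Sym n)) (sum-map-filterᵇ isPermutation (𝟙 ∘ hasExactlyKCycles k m) (vecs (allFin n) n))

    sumVal≡sum-weight : ∀ n → sumVal k n m ≡ sum (map (λ σ → weight k m σ * valAt1 σ) (vecs (allFin n) n))
    sumVal≡sum-weight n = begin
      sum (map valAt1 (filterᵇ (hasExactlyKCycles k m) (Sym n)))
        ≡⟨ sum-map-filterᵇ _ valAt1 (Sym n) ⟩
      sum (map (λ σ → 𝟙 (hasExactlyKCycles k m σ) * valAt1 σ) (Sym n))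
        ≡⟨ sum-map-filterᵇ isPermutation _ (vecs (allFin n) n) ⟩
      sum (map (λ σ → 𝟙 (isPermutation σ) * (𝟙 (hasExactlyKCycles k m σ) * valAt1 σ)) (vecs (allFin n) n))
        ≡⟨ sum-map-cong (λ σ → sym (*-assoc (𝟙 (isPermutation σ)) _ _)) (vecs (allFin n) n) ⟩
      sum (map (λ σ → weight k m σ * valAt1 σ) (vecs (allFin n) n))
        ∎
      where open ≡-Reasoning

    weight-conj : ∀ {n} (π : Permutation′ n) σ → weight k m (conj π σ) ≡ weight k m σ
    weight-conj π σ = cong₂ (λ p q → 𝟙 p * 𝟙 (q ≡ᵇ m * k)) (isPermutation-conj π σ) (pointsInKCycles-conj π k σ)

    weight-fix₀ : ∀ {n} → 1 < k → (ρ : Vec (Fin n) n) → weight k m (fix₀ ρ) ≡ weight k m ρ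
    weight-fix₀ 1<k ρ = cong₂ (λ p q → 𝟙 p * 𝟙 (q ≡ᵇ m * k)) (isPermutation-fix₀ ρ) (pointsInKCycles-fix₀ ρ k 1<k)

    weight-∷-repeated : ∀ {n} x (v : Vec (Fin (suc n)) n) i → lookup v i ≡ x → weight k m (x ∷ v) ≡ 0
    weight-∷-repeated x v i vᵢ≡x with isInjective (x ∷ v) in eq
    ... | false = refl
    ... | true  with () ← to (T-isInjective (x ∷ v)) (subst T (sym eq) _) {zero} {suc i} (sym vᵢ≡x)

    fibre : ∀ n → Fin (suc n) → ℕ
    fibre n x = sum (map (λ v → weight k m (x ∷ v)) (vecs (allFin (suc n)) n))

    sum-weight-by-head : ∀ n (g : Fin (suc n) → ℕ) →
                         sum (map (λ σ → weight k m σ * g (head σ)) (vecs (allFin (suc n)) (suc n)))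
                         ≡ sum (map (λ x → fibre n x * g x) (allFin (suc n)))
    sum-weight-by-head n g =
      trans (sum-vecs-suc (allFin (suc n)) n _)
            (sum-map-cong (λ x → sum-map-*ʳ (λ v → weight k m (x ∷ v)) (g x) (vecs (allFin (suc n)) n)) (allFin (suc n)))

    C-by-fibre : ∀ n → C k (suc n) m ≡ sum (map (fibre n) (allFin (suc n)))
    C-by-fibre n = trans (C≡sum-weight (suc n)) (sum-vecs-suc (allFin (suc n)) n (weight k m))

    sumVal-by-fibre : ∀ n → sumVal k (suc n) m ≡ sum (map (λ x → fibre n x * suc (toℕ x)) (allFin (suc n)))
    sumVal-by-fibre n = trans (sumVal≡sum-weight (suc n)) (sum-weight-by-head n (suc ∘ toℕ))

    fibre-by-head : ∀ n x →
                    fibre n x ≡ sum (map (λ σ → weight k m σ * 𝟙 ⌊ head σ ≟ x ⌋) (vecs (allFin (suc n)) (suc n)))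
    fibre-by-head n x =
      trans (sym (sum-allFin-indicator (suc n) (fibre n) x)) (sym (sum-weight-by-head n (λ y → 𝟙 ⌊ y ≟ x ⌋)))

    fibre-conj : ∀ n (π : Permutation′ (suc n)) → π ⟨$⟩ʳ zero ≡ zero → ∀ x → fibre n (π ⟨$⟩ʳ x) ≡ fibre n x
    fibre-conj n π π0≡0 x = begin
      fibre n (π ⟨$⟩ʳ x)
        ≡⟨ fibre-by-head n (π ⟨$⟩ʳ x) ⟩
      sum (map (λ σ → weight k m σ * 𝟙 ⌊ head σ ≟ π ⟨$⟩ʳ x ⌋) Σₙ)
        ≡⟨ sum-map-reindex Σₙ (vecs-unique _ (Unique.allFin⁺ (suc n)) (suc n)) (∈-vecs _ ∈-allFin (suc n))
                           (conj π) (conj (flip π)) (conj-flip-conj π) (conj-flip-conj (flip π)) _ ⟨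
      sum (map (λ σ → weight k m (conj π σ) * 𝟙 ⌊ head (conj π σ) ≟ π ⟨$⟩ʳ x ⌋) Σₙ)
        ≡⟨ sum-map-cong (λ σ → cong₂ _*_ (weight-conj π σ) (cong 𝟙 (head-conj σ))) Σₙ ⟩
      sum (map (λ σ → weight k m σ * 𝟙 ⌊ head σ ≟ x ⌋) Σₙ)
        ≡⟨ fibre-by-head n x ⟨
      fibre n x
        ∎
      where
      open ≡-Reasoning
      Σₙ = vecs (allFin (suc n)) (suc n)
      head-conj : ∀ σ → ⌊ head (conj π σ) ≟ π ⟨$⟩ʳ x ⌋ ≡ ⌊ head σ ≟ x ⌋
      head-conj (a ∷ σ) = trans (cong (λ i → ⌊ π ⟨$⟩ʳ lookup (a ∷ σ) i ≟ π ⟨$⟩ʳ x ⌋) π⁻¹0≡0)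
                                (⌊⌋-⇔ (mk⇔ (injective (↔⇒↣ π)) (cong (π ⟨$⟩ʳ_))) _ _)
        where
        π⁻¹0≡0 : π ⟨$⟩ˡ zero ≡ zero
        π⁻¹0≡0 = trans (cong (π ⟨$⟩ˡ_) (sym π0≡0)) (inverseˡ π)

    fibre-zero : ∀ n → 1 < k → fibre n zero ≡ C k n m
    fibre-zero n 1<k = begin
      sum (map (λ v → weight k m (zero ∷ v)) (vecs (allFin (suc n)) n))
        ≡⟨ cong (λ xs → sum (map (λ v → weight k m (zero ∷ v)) (vecs xs n))) (allFin-suc n) ⟩
      sum (map (λ v → weight k m (zero ∷ v)) (vecs (zero ∷ map suc (allFin n)) n))
        ≡⟨ sum-vecs-∷-vanishing zero _ n _ (weight-∷-repeated zero) ⟩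
      sum (map (λ v → weight k m (zero ∷ v)) (vecs (map suc (allFin n)) n))
        ≡⟨ cong (sum ∘ map _) (vecs-map suc (allFin n) n) ⟩
      sum (map (λ v → weight k m (zero ∷ v)) (map (Vec.map suc) (vecs (allFin n) n)))
        ≡⟨ cong sum (map-∘ (vecs (allFin n) n)) ⟨
      sum (map (weight k m ∘ fix₀) (vecs (allFin n) n))
        ≡⟨ sum-map-cong (weight-fix₀ 1<k) (vecs (allFin n) n) ⟩
      sum (map (weight k m) (vecs (allFin n) n))
        ≡⟨ C≡sum-weight n ⟨
      C k n m
        ∎
      where open ≡-Reasoning

    fibre-suc-constant : ∀ n → ∃ λ M → ∀ (y : Fin n) → fibre n (suc y) ≡ M
    fibre-suc-constant zero    = 0 , λ ()
    -- lift₀ (transpose zero y) fixes 0 and sends suc zero to suc y, both by computation.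
    fibre-suc-constant (suc n) =
      fibre (suc n) (suc zero) , λ y → fibre-conj (suc n) (lift₀ (transpose zero y)) refl (suc zero)

    module _ (n M : ℕ) (1<k : 1 < k) (fibre-suc≡M : ∀ (y : Fin n) → fibre n (suc y) ≡ M) where

      C-suc : C k (suc n) m ≡ C k n m + n * M
      C-suc = begin
        C k (suc n) m
          ≡⟨ C-by-fibre n ⟩
        sum (map (fibre n) (allFin (suc n)))
          ≡⟨ sum-allFin-suc n (fibre n) ⟩
        fibre n zero + sum (map (fibre n ∘ suc) (allFin n))
          ≡⟨ cong₂ _+_ (fibre-zero n 1<k) (sum-map-cong fibre-suc≡M (allFin n)) ⟩
        C k n m + sum (map (λ _ → M) (allFin n))
          ≡⟨ cong (C k n m +_) (sum-allFin-const n M) ⟩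
        C k n m + n * M
          ∎
        where open ≡-Reasoning

      sumVal-suc : sumVal k (suc n) m ≡ C k n m * 1 + M * sum (map (λ y → 2 + toℕ y) (allFin n))
      sumVal-suc = begin
        sumVal k (suc n) m
          ≡⟨ sumVal-by-fibre n ⟩
        sum (map (λ x → fibre n x * suc (toℕ x)) (allFin (suc n)))
          ≡⟨ sum-allFin-suc n _ ⟩
        fibre n zero * 1 + sum (map (λ y → fibre n (suc y) * (2 + toℕ y)) (allFin n))
          ≡⟨ cong₂ _+_ (cong (_* 1) (fibre-zero n 1<k))
                       (sum-map-cong (λ y → cong (_* (2 + toℕ y)) (fibre-suc≡M y)) (allFin n)) ⟩
        C k n m * 1 + sum (map (λ y → M * (2 + toℕ y)) (allFin n))
          ≡⟨ cong (C k n m * 1 +_) (sum-map-*ˡ M (λ y → 2 + toℕ y) (allFin n)) ⟩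
        C k n m * 1 + M * sum (map (λ y → 2 + toℕ y) (allFin n))
          ∎
        where open ≡-Reasoning

      double-sumVal : 2 * sumVal k (suc n) m ≡ 2 * C k (suc n) m + suc n * (n * M)
      double-sumVal = begin
        2 * sumVal k (suc n) m                ≡⟨ cong (2 *_) sumVal-suc ⟩
        2 * (c₀ * 1 + M * S)                  ≡⟨ regroup c₀ M S ⟩
        2 * c₀ + M * (2 * S)                  ≡⟨ cong (λ t → 2 * c₀ + M * t) (arithmetic-series n 1) ⟩
        2 * c₀ + M * (n * (2 * 1 + suc n))    ≡⟨ expand c₀ M n ⟩
        2 * (c₀ + n * M) + suc n * (n * M)    ≡⟨ cong (λ c → 2 * c + suc n * (n * M)) C-suc ⟨
        2 * C k (suc n) m + suc n * (n * M)   ∎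
        where
        open ≡-Reasoning
        c₀ = C k n m
        S  = sum (map (λ y → 2 + toℕ y) (allFin n))
        regroup : ∀ c₀ M S → 2 * (c₀ * 1 + M * S) ≡ 2 * c₀ + M * (2 * S)
        regroup = solve-∀
        expand : ∀ c₀ M n → 2 * c₀ + M * (n * (2 * 1 + suc n)) ≡ 2 * (c₀ + n * M) + suc n * (n * M)
        expand = solve-∀

open import Defs using (C; sumVal)
open import Data.Nat as ℕ using (ℕ; zero; suc; _<_; _≤_; pred; s≤s; z≤n; >-nonZero)
import Data.Nat.Properties as ℕ
open import Data.Integer as ℤ using (+_)
import Data.Integer.Properties as ℤ
open import Data.Rational using (ℚ; _/_; _*_; _+_; _-_; 1ℚ; toℚᵘ)
open import Data.Rational.Properties using (*-identityˡ; toℚᵘ-injective; toℚᵘ-fromℚᵘ; toℚᵘ-homo-+; toℚᵘ-homo-*)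
open import Data.Rational.Unnormalised as ℚᵘ using (mkℚᵘ; *≡*)
import Data.Rational.Unnormalised.Properties as ℚᵘ
open import Data.Rational.Solver using (module +-*-Solver)
open import Data.Product using (_,_)
open import Relation.Binary.PropositionalEquality

fromℕ : ℕ → ℚ
fromℕ x = + x / 1

toℚᵘ-/ : ∀ x c → toℚᵘ ((+ x) / suc c) ℚᵘ.≃ mkℚᵘ (+ x) c
toℚᵘ-/ x c = toℚᵘ-fromℚᵘ (mkℚᵘ (+ x) c)

fromℕ-+ : ∀ a b → fromℕ (a ℕ.+ b) ≡ fromℕ a + fromℕ b
fromℕ-+ a b = toℚᵘ-injective (begin-equality
  toℚᵘ (fromℕ (a ℕ.+ b))                 ≃⟨ toℚᵘ-/ (a ℕ.+ b) 0 ⟩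
  mkℚᵘ (+ (a ℕ.+ b)) 0                   ≃⟨ *≡* cross ⟩
  mkℚᵘ (+ a) 0 ℚᵘ.+ mkℚᵘ (+ b) 0         ≃⟨ ℚᵘ.+-cong (toℚᵘ-/ a 0) (toℚᵘ-/ b 0) ⟨
  toℚᵘ (fromℕ a) ℚᵘ.+ toℚᵘ (fromℕ b)     ≃⟨ toℚᵘ-homo-+ (fromℕ a) (fromℕ b) ⟨
  toℚᵘ (fromℕ a + fromℕ b)               ∎)
  where
  open ℚᵘ.≤-Reasoning
  cross : + (a ℕ.+ b) ℤ.* + 1 ≡ (+ a ℤ.* + 1 ℤ.+ + b ℤ.* + 1) ℤ.* + 1
  cross rewrite ℤ.*-identityʳ (+ a) | ℤ.*-identityʳ (+ b) | ℤ.*-identityʳ (+ a ℤ.+ + b) = refl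

fromℕ-* : ∀ a b → fromℕ (a ℕ.* b) ≡ fromℕ a * fromℕ b
fromℕ-* a b = toℚᵘ-injective (begin-equality
  toℚᵘ (fromℕ (a ℕ.* b))                 ≃⟨ toℚᵘ-/ (a ℕ.* b) 0 ⟩
  mkℚᵘ (+ (a ℕ.* b)) 0                   ≃⟨ *≡* cross ⟩
  mkℚᵘ (+ a) 0 ℚᵘ.* mkℚᵘ (+ b) 0         ≃⟨ ℚᵘ.*-cong (toℚᵘ-/ a 0) (toℚᵘ-/ b 0) ⟨
  toℚᵘ (fromℕ a) ℚᵘ.* toℚᵘ (fromℕ b)     ≃⟨ toℚᵘ-homo-* (fromℕ a) (fromℕ b) ⟨
  toℚᵘ (fromℕ a * fromℕ b)               ∎)
  where
  open ℚᵘ.≤-Reasoning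
  cross : + (a ℕ.* b) ℤ.* + 1 ≡ (+ a ℤ.* + b) ℤ.* + 1
  cross = cong (ℤ._* + 1) (ℤ.pos-* a b)

/-as-* : ∀ x c → (+ x) / suc c ≡ fromℕ x * ((+ 1) / suc c)
/-as-* x c = toℚᵘ-injective (begin-equality
  toℚᵘ ((+ x) / suc c)                         ≃⟨ toℚᵘ-/ x c ⟩
  mkℚᵘ (+ x) c                                 ≃⟨ *≡* cross ⟩
  mkℚᵘ (+ x) 0 ℚᵘ.* mkℚᵘ (+ 1) c               ≃⟨ ℚᵘ.*-cong (toℚᵘ-/ x 0) (toℚᵘ-/ 1 c) ⟨
  toℚᵘ (fromℕ x) ℚᵘ.* toℚᵘ ((+ 1) / suc c)     ≃⟨ toℚᵘ-homo-* (fromℕ x) ((+ 1) / suc c) ⟨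
  toℚᵘ (fromℕ x * ((+ 1) / suc c))             ∎)
  where
  open ℚᵘ.≤-Reasoning
  cross : + x ℤ.* + suc (c ℕ.+ 0) ≡ (+ x ℤ.* + 1) ℤ.* + suc c
  cross rewrite ℕ.+-identityʳ c | ℤ.*-identityʳ (+ x) = refl

fromℕ-*-inverse : ∀ c → fromℕ (suc c) * ((+ 1) / suc c) ≡ 1ℚ
fromℕ-*-inverse c = trans (sym (/-as-* (suc c) c))
  (toℚᵘ-injective (ℚᵘ.≃-trans (toℚᵘ-/ (suc c) c) (*≡* (ℤ.*-comm (+ suc c) (+ 1)))))

ratio-identity : ∀ s c c₀ d n (0<c : 0 < c) → c₀ ℕ.+ d ≡ c → 2 ℕ.* s ≡ 2 ℕ.* c ℕ.+ n ℕ.* d →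
                 _/_ (+ s) c {{>-nonZero 0<c}} ≡ ((+ n) / 2) * (1ℚ - _/_ (+ c₀) c {{>-nonZero 0<c}}) + 1ℚ
ratio-identity s (suc c) c₀ d n (s≤s z≤n) c₀+d≡c 2s≡2c+nd = begin
  (+ s) / suc c
    ≡⟨ /-as-* s c ⟩
  S * u
    -- Two * h computes to 1ℚ
    ≡⟨ *-identityˡ (S * u) ⟨
  (Two * h) * (S * u)
    ≡⟨ solve 4 (λ S u Two h → (Two :* h) :* (S :* u) := h :* ((Two :* S) :* u)) refl S u Two h ⟩
  h * ((Two * S) * u)
    ≡⟨ cong (λ t → h * (t * u)) Two*S≡Two*[C₀+D]+N*D ⟩
  h * ((Two * (C₀ + D) + N * D) * u)
    ≡⟨ solve 6 (λ C₀ D N u Two h → h :* ((Two :* (C₀ :+ D) :+ N :* D) :* u)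
                                 := (Two :* h) :* ((C₀ :+ D) :* u) :+ (N :* h) :* ((C₀ :+ D) :* u :- C₀ :* u))
               refl C₀ D N u Two h ⟩
  (Two * h) * ((C₀ + D) * u) + (N * h) * ((C₀ + D) * u - C₀ * u)
    ≡⟨ cong (λ t → (Two * h) * t + (N * h) * (t - C₀ * u)) [C₀+D]*u≡1 ⟩
  1ℚ * 1ℚ + (N * h) * (1ℚ - C₀ * u)
    ≡⟨ solve 3 (λ N h x → con 1ℚ :* con 1ℚ :+ (N :* h) :* (con 1ℚ :- x) := (N :* h) :* (con 1ℚ :- x) :+ con 1ℚ)
               refl N h (C₀ * u) ⟩
  (N * h) * (1ℚ - C₀ * u) + 1ℚ
    ≡⟨ cong₂ (λ a b → a * (1ℚ - b) + 1ℚ) (/-as-* n 1) (/-as-* c₀ c) ⟨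
  ((+ n) / 2) * (1ℚ - (+ c₀) / suc c) + 1ℚ
    ∎
  where
  open ≡-Reasoning
  open +-*-Solver
  S C₀ D N Two : ℚ
  S   = fromℕ s
  C₀  = fromℕ c₀
  D   = fromℕ d
  N   = fromℕ n
  Two = fromℕ 2
  u h : ℚ
  u = (+ 1) / suc c
  h = (+ 1) / 2
  [C₀+D]*u≡1 : (C₀ + D) * u ≡ 1ℚ
  [C₀+D]*u≡1 = trans (cong (_* u) (trans (sym (fromℕ-+ c₀ d)) (cong fromℕ c₀+d≡c))) (fromℕ-*-inverse c)
  Two*S≡Two*[C₀+D]+N*D : Two * S ≡ Two * (C₀ + D) + N * D
  Two*S≡Two*[C₀+D]+N*D = begin
    Two * S
      ≡⟨ fromℕ-* 2 s ⟨
    fromℕ (2 ℕ.* s)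
      ≡⟨ cong fromℕ (trans 2s≡2c+nd (cong (λ c → 2 ℕ.* c ℕ.+ n ℕ.* d) (sym c₀+d≡c))) ⟩
    fromℕ (2 ℕ.* (c₀ ℕ.+ d) ℕ.+ n ℕ.* d)
      ≡⟨ fromℕ-+ (2 ℕ.* (c₀ ℕ.+ d)) (n ℕ.* d) ⟩
    fromℕ (2 ℕ.* (c₀ ℕ.+ d)) + fromℕ (n ℕ.* d)
      ≡⟨ cong₂ _+_ (trans (fromℕ-* 2 (c₀ ℕ.+ d)) (cong (Two *_) (fromℕ-+ c₀ d))) (fromℕ-* n d) ⟩
    Two * (C₀ + D) + N * D
      ∎

open Counting using (C-suc; double-sumVal; fibre-suc-constant)

theorem2p7 : (k n m : ℕ) → 1 < k → 1 ≤ n → (hC : 0 < C k n m) →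
    _/_ (+ sumVal k n m) (C k n m) {{>-nonZero hC}}
    ≡ ((+ n) / 2) * (1ℚ - _/_ (+ C k (pred n) m) (C k n m) {{>-nonZero hC}}) + 1ℚ
theorem2p7 k zero    m 1<k () hC
theorem2p7 k (suc n) m 1<k _  hC =
  let (M , fibre-suc≡M) = fibre-suc-constant k m n in
  ratio-identity (sumVal k (suc n) m) (C k (suc n) m) (C k n m) (n ℕ.* M) (suc n) hC
    (sym (C-suc k m n M 1<k fibre-suc≡M)) (double-sumVal k m n M 1<k fibre-suc≡M)
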